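{- Let $S$ be an opetopic cardinal. Then its associated positive-to-one poset satisfies acyclicity: for $x\in S_1$, $\delta(x)$ is a singleton; for $x$ of dimension $\ge1$, $\delta(x)\neq\emptyset$, and there are no $p\ge1$ and $y_1,\dots,y_p\in\delta(x)$ with $\gamma(y_{i+1})\in\delta(y_i)$ for $1\le i<p$ and $\gamma(y_1)\in\delta(y_p)$.
   Context: A positive hypergraph $S$ consists of finite sets $S_k$ ($k\in\mathbb{N}$), all but finitely many empty, and maps $\gamma:S_{k+1}\to S_k$, $\delta:S_{k+1}\to\mathcal{P}(S_k)$ with $\delta(a)\neq\emptyset$ for all $a$ and $\delta(a)$ a singleton for $a\in S_1$. For $a\in S_{k+2}$: $\gamma\gamma(a)=\{\gamma(\gamma(a))\}$, $\gamma\delta(a)=\{\gamma(x):x\in\delta(a)\}$, $\delta\gamma(a)=\delta(\gamma(a))$, $\delta\delta(a)=\bigcup_{x\in\delta(a)}\delta(x)$. For $a,b\in S_k$: $a\triangleleft^+b$ iff there is $\alpha\in S_{k+1}$ with $a\in\delta(\alpha)$, $\gamma(\alpha)=b$, and $<^+$ is its transitive closure; for $k\ge1$, $a\triangleleft^-b$ iff $\gamma(a)\in\delta(b)$, and $<^-$ is its transitive closure. An opetopic cardinal is a positive hypergraph satisfying: globularity (for $a\in S_{\ge2}$, $\gamma\gamma(a)=\gamma\delta(a)\setminus\delta\delta(a)$ and $\delta\gamma(a)=\delta\delta(a)\setminus\gamma\delta(a)$); strictness (each $<^+$ on $S_k$ is a strict partial order, and $<^+$ on $S_0$ is total); disjointness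 (for $k>0$, no $a,b\in S_k$ are comparable both for $<^+$ and for $<^-$); pencil linearity (for $k>0$, $x\in S_{k-1}$, the sets $\{a\in S_k:x\in\delta(a)\}$ and $\{a\in S_k:\gamma(a)=x\}$ are linearly ordered by $<^+$). The associated positive-to-one poset has elements $\bigsqcup_kS_k$, $\dim x=k$ for $x\in S_k$, $y\prec^-x$ iff $y\in\delta(x)$, $y\prec^+x$ iff $y=\gamma(x)$. -}

module Defs where

open import Data.Nat using (ℕ; zero; suc; _≤_)
open import Data.Fin using (Fin; zero; suc; inject₁; fromℕ)
open import Data.Fin.Subset using (Subset; _∈_; _∉_; Nonempty; ⁅_⁆)
open import Data.Product using (Σ; ∃; ∃-syntax; _×_; _,_)
open import Data.Sum using (_⊎_)
open import Relation.Nullary using (¬_)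
open import Relation.Binary.PropositionalEquality using (_≡_)
open import Relation.Binary.Construct.Closure.Transitive using (TransClosure)
open import Relation.Binary.Structures using (IsStrictPartialOrder)
open import Function.Bundles using (_⇔_)

record PositiveHypergraph : Set₁ where
  field
    card   : ℕ → ℕ
    height : ℕ
    finitelyMany : ∀ k → height ≤ k → card k ≡ 0
    γ : ∀ k → Fin (card (suc k)) → Fin (card k)
    δ : ∀ k → Fin (card (suc k)) → Subset (card k)
    δ-nonempty : ∀ k (a : Fin (card (suc k))) → Nonempty (δ k a)
    δ-singleton₁ : ∀ (a : Fin (card 1)) → ∃[ y ] δ 0 a ≡ ⁅ y ⁆

  S : ℕ → Set
  S k = Fin (card k)

  _∈γγ_ : ∀ {k} → S k → S (suc (suc k)) → Set
  _∈γγ_ {k} z a = z ≡ γ k (γ (suc k) a)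

  _∈γδ_ : ∀ {k} → S k → S (suc (suc k)) → Set
  _∈γδ_ {k} z a = ∃[ x ] (x ∈ δ (suc k) a × γ k x ≡ z)

  _∈δγ_ : ∀ {k} → S k → S (suc (suc k)) → Set
  _∈δγ_ {k} z a = z ∈ δ k (γ (suc k) a)

  _∈δδ_ : ∀ {k} → S k → S (suc (suc k)) → Set
  _∈δδ_ {k} z a = ∃[ x ] (x ∈ δ (suc k) a × z ∈ δ k x)

  _◁⁺_ : ∀ {k} → S k → S k → Set
  _◁⁺_ {k} a b = ∃[ α ] (a ∈ δ k α × γ k α ≡ b)

  _<⁺_ : ∀ {k} → S k → S k → Set
  _<⁺_ {k} = TransClosure (_◁⁺_ {k})

  _◁⁻_ : ∀ {k} → S (suc k) → S (suc k) → Set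
  _◁⁻_ {k} a b = γ k a ∈ δ k b

  _<⁻_ : ∀ {k} → S (suc k) → S (suc k) → Set
  _<⁻_ {k} = TransClosure (_◁⁻_ {k})

record OpetopicCardinal : Set₁ where
  field
    hypergraph : PositiveHypergraph
  open PositiveHypergraph hypergraph public
  field
    globularity-γ : ∀ k (a : S (suc (suc k))) (z : S k) →
      (z ∈γγ a) ⇔ ((z ∈γδ a) × ¬ (z ∈δδ a))
    globularity-δ : ∀ k (a : S (suc (suc k))) (z : S k) →
      (z ∈δγ a) ⇔ ((z ∈δδ a) × ¬ (z ∈γδ a))
    strictness : ∀ k → IsStrictPartialOrder _≡_ (_<⁺_ {k})
    total₀ : ∀ (a b : S 0) → a ≡ b ⊎ a <⁺ b ⊎ b <⁺ a
    disjointness : ∀ k (a b : S (suc k)) →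
      ¬ ((a <⁺ b ⊎ b <⁺ a) × (a <⁻ b ⊎ b <⁻ a))
    pencil-δ : ∀ k (x : S k) (a b : S (suc k)) → x ∈ δ k a → x ∈ δ k b →
      a ≡ b ⊎ a <⁺ b ⊎ b <⁺ a
    pencil-γ : ∀ k (x : S k) (a b : S (suc k)) → γ k a ≡ x → γ k b ≡ x →
      a ≡ b ⊎ a <⁺ b ⊎ b <⁺ a

module AssociatedPoset (H : PositiveHypergraph) where
  open PositiveHypergraph H

  Elem : Set
  Elem = Σ ℕ S

  dim : Elem → ℕ
  dim (k , _) = k

  data _≺⁻_ : Elem → Elem → Set where
    minus : ∀ {k} {y : S k} {x : S (suc k)} → y ∈ δ k x → (k , y) ≺⁻ (suc k , x)

  data _≺⁺_ : Elem → Elem → Set where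
    plus : ∀ {k} {y : S k} {x : S (suc k)} → y ≡ γ k x → (k , y) ≺⁺ (suc k , x)

  -- "γ(y') ∈ δ(y)" phrased in the poset: the ≺⁺-face of y' is a ≺⁻-face of y
  _⇝_ : Elem → Elem → Set
  y' ⇝ y = ∃[ z ] (z ≺⁺ y' × z ≺⁻ y)

  record Acyclic : Set where
    field
      singleton₁ : ∀ x → dim x ≡ 1 →
        ∃[ y ] (y ≺⁻ x × (∀ y' → y' ≺⁻ x → y' ≡ y))
      nonempty : ∀ x → 1 ≤ dim x → ∃[ y ] (y ≺⁻ x)
      noCycle : ∀ x (p : ℕ) (ys : Fin (suc p) → Elem) →
        (∀ i → ys i ≺⁻ x) →
        (∀ (i : Fin p) → ys (suc i) ⇝ ys (inject₁ i)) →
        ¬ (ys zero ⇝ ys (fromℕ p))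

-- If γ(y') ∈ δ(y) then y itself witnesses γ(y') ◁⁺ γ(y).  Hence a cycle
-- y₁, …, y_p as in the acyclicity condition gives a ◁⁺-cycle on the targets
-- γ(y_i), which strictness of <⁺ forbids.
module Submission where

open import Defs
open import Data.Nat using (ℕ; zero; suc; _≤_)
open import Data.Nat.Properties using (≡-irrelevant)
open import Data.Fin using (Fin; zero; suc; inject₁; fromℕ)
open import Data.Fin.Subset using (_∈_)
open import Data.Fin.Subset.Properties using (x∈⁅x⁆; x∈⁅y⁆⇒x≡y)
open import Data.Product using (∃-syntax; _×_; _,_)
open import Data.Product.Properties using (,-injectiveʳ-UIP)
open import Function using (_∘_)
open import Relation.Nullary using (¬_)
open import Relation.Binary.Definitions using (Irreflexive)
open import Relation.Binary.PropositionalEquality using (_≡_; refl; subst; sym; cong)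
open import Relation.Binary.Construct.Closure.Transitive using (TransClosure; [_]; _∷_; _∷ʳ_)
open import Relation.Binary.Structures using (IsStrictPartialOrder)

module Acyclicity (H : PositiveHypergraph) where
  open PositiveHypergraph H
  open AssociatedPoset H

  -- Elements of dimension 0 have no target; `target` is the identity there.
  target : Elem → Elem
  target (zero  , a) = (zero , a)
  target (suc k , a) = (k , γ k a)

  data _⊏_ : Elem → Elem → Set where
    lift : ∀ {k} {a b : S k} → a ◁⁺ b → (k , a) ⊏ (k , b)

  _⊏⁺_ : Elem → Elem → Set
  _⊏⁺_ = TransClosure _⊏_

  ⊏⁺-within-level : ∀ {k} {a : S k} {e} → (k , a) ⊏⁺ e → ∃[ b ] (e ≡ (k , b) × a <⁺ b)
  ⊏⁺-within-level [ lift a◁b ] = _ , refl , [ a◁b ]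
  ⊏⁺-within-level (lift a◁b ∷ rest) with ⊏⁺-within-level rest
  ... | c , refl , b<c = c , refl , a◁b ∷ b<c

  ⊏⁺⇒<⁺ : ∀ {k} {a b : S k} → (k , a) ⊏⁺ (k , b) → a <⁺ b
  ⊏⁺⇒<⁺ r with ⊏⁺-within-level r
  ... | c , eq , a<c = subst (_ <⁺_) (sym (,-injectiveʳ-UIP ≡-irrelevant eq)) a<c

  ⇝⇒target-⊏ : ∀ {y' y} → y' ⇝ y → target y' ⊏ target y
  ⇝⇒target-⊏ (_ , plus refl , minus {x = y} γy'∈δy) = lift (y , γy'∈δy , refl)

  ⇝-path⇒⊏⁺ : ∀ p (ys : Fin (suc p) → Elem) →
    (∀ (i : Fin p) → ys (suc i) ⇝ ys (inject₁ i)) →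
    ∀ {e} → e ⊏⁺ target (ys (fromℕ p)) → e ⊏⁺ target (ys zero)
  ⇝-path⇒⊏⁺ zero    ys path r = r
  ⇝-path⇒⊏⁺ (suc p) ys path r =
    ⇝-path⇒⊏⁺ p (ys ∘ suc) (path ∘ suc) r ∷ʳ ⇝⇒target-⊏ (path zero)

  singleton₁ : ∀ x → dim x ≡ 1 → ∃[ y ] (y ≺⁻ x × (∀ y' → y' ≺⁻ x → y' ≡ y))
  singleton₁ (1 , a) refl with δ-singleton₁ a
  ... | y , δa≡⁅y⁆ = (0 , y) , minus (subst (y ∈_) (sym δa≡⁅y⁆) (x∈⁅x⁆ y)) , unique
    where
    unique : ∀ y' → y' ≺⁻ (1 , a) → y' ≡ (0 , y)
    unique _ (minus y'∈δa) = cong (0 ,_) (x∈⁅y⁆⇒x≡y y (subst (_ ∈_) δa≡⁅y⁆ y'∈δa))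

  nonempty : ∀ x → 1 ≤ dim x → ∃[ y ] (y ≺⁻ x)
  nonempty (suc k , a) _ with δ-nonempty k a
  ... | y , y∈δa = (k , y) , minus y∈δa

  acyclic : (∀ k → Irreflexive _≡_ (_<⁺_ {k})) → Acyclic
  acyclic <⁺-irrefl = record
    { singleton₁ = singleton₁
    ; nonempty   = nonempty
    ; noCycle    = noCycle
    }
    where
    ⊏⁺-irrefl : ∀ {e} → ¬ (e ⊏⁺ e)
    ⊏⁺-irrefl {k , _} r = <⁺-irrefl k refl (⊏⁺⇒<⁺ r)

    noCycle : ∀ x (p : ℕ) (ys : Fin (suc p) → Elem) →
      (∀ i → ys i ≺⁻ x) →
      (∀ (i : Fin p) → ys (suc i) ⇝ ys (inject₁ i)) →
      ¬ (ys zero ⇝ ys (fromℕ p))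
    noCycle _ p ys _ path closing =
      ⊏⁺-irrefl (⇝-path⇒⊏⁺ p ys path [ ⇝⇒target-⊏ closing ])

mainTheorem13 : (S : OpetopicCardinal) →
    AssociatedPoset.Acyclic (OpetopicCardinal.hypergraph S)
mainTheorem13 S =
  Acyclicity.acyclic hypergraph (λ k → IsStrictPartialOrder.irrefl (strictness k))
  where open OpetopicCardinal S
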